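{- Let $K$ be a complete discrete valuation field of characteristic $p>0$, and let $m\ge2$, $r\ge0$ be integers. (i) Assume $r\ge1$. Then $\mathrm{gr}'^{(r)}_mK=\mathrm{gr}_{[m/p^r]}K$ if $m\in p^{r+1}\mathbf{Z}$ or $\mathrm{ord}_p(m-1)=r$, and $\mathrm{gr}'^{(r)}_mK=0$ otherwise. (ii) $\mathrm{gr}''^{(r)}_mK=\mathrm{gr}_{m/p^{r+1}}K$ if $m\in p^{r+1}\mathbf{Z}$, and $\mathrm{gr}''^{(r)}_mK=0$ if $m\notin p^{r+1}\mathbf{Z}$.
   Context: $\mathrm{ord}_K$ normalized valuation; $\mathrm{fil}_nK=\{a\in K:\mathrm{ord}_K(a)\ge-n\}$, $\mathrm{gr}_nK=\mathrm{fil}_nK/\mathrm{fil}_{n-1}K$; $[q]$ is the integer $n$ with $q-1<n\le q$. For $m\ge1$, with $r'=\min\{\mathrm{ord}_p(m),1+r\}$ and $s''=\max\{0,r'-r\}\in\{0,1\}$: $\mathrm{fil}'^{(r)}_mK=\mathrm{fil}_{[(m-1)/p^r]}K+\mathrm{fil}_{[m/p^r]}W_{s''}(K)$ and $\mathrm{fil}''^{(r)}_mK=\mathrm{fil}_{[[(m-1)/p]/p^r]}K+\mathrm{fil}_{[[m/p]/p^r]}W_{s''}(K)$, where $W_0(K)=0$ and $W_1(K)=K$ (so the second summand is present only when $s''=1$). $\mathrm{gr}'^{(r)}_m=\mathrm{fil}'^{(r)}_m/\mathrm{fil}'^{(r)}_{m-1}$ and $\mathrm{gr}''^{(r)}_m=\mathrm{fil}''^{(r)}_m/\mathrm{fil}''^{(r)}_{m-1}$.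 -}

module Defs where

open import Level using (Level; _⊔_; suc)
open import Algebra.Bundles using (CommutativeRing)
open import Data.Nat as ℕ using (ℕ; zero; _∸_; _^_; _⊓_)
import Data.Nat.DivMod as ℕD
open import Data.Nat.Divisibility using (_∣_; _∣?_)
open import Data.Nat.Primality using (Prime)
open import Data.Integer as ℤ using (ℤ)
open import Data.Maybe using (Maybe; just; nothing)
open import Data.Product using (Σ; ∃; _×_; _,_)
open import Data.Unit using (⊤)
open import Relation.Binary.PropositionalEquality using (_≡_)
open import Relation.Nullary using (¬_; yes; no)
open import Function.Bundles using (_⇔_)

-- floor division  fl a b = [a / b]  (the integer n with a/b - 1 < n ≤ a/b);
-- only ever used with b ≥ 1 (b = 0 returns 0 as a junk value).
fl : ℕ → ℕ → ℕ
fl a zero    = 0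
fl a (ℕ.suc b) = a ℕD./ ℕ.suc b

-- ordMin p m k = min (ord_p m , k), computed by stripping at most k
-- factors of p from m (for m ≥ 1, p ≥ 2).
ordMin : ℕ → ℕ → ℕ → ℕ
ordMin p m zero = 0
ordMin p m (ℕ.suc k) with p ∣? m
... | yes _ = ℕ.suc (ordMin p (fl m p) k)
... | no  _ = 0

-- the p-adic order of m ≥ 1 (for p ≥ 2 we have ord_p m < m,
-- so min (ord_p m , m) = ord_p m)
ordp : ℕ → ℕ → ℕ
ordp p m = ordMin p m m

-- "at least":  AtLeast v n  means  v ≥ n,  for v ∈ ℤ ∪ {∞}  (∞ = nothing)
AtLeast : Maybe ℤ → ℤ → Set
AtLeast nothing  n = ⊤
AtLeast (just k) n = n ℤ.≤ k

_+∞_ : Maybe ℤ → Maybe ℤ → Maybe ℤ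
just a +∞ just b = just (a ℤ.+ b)
_      +∞ _      = nothing

module _ {c ℓ : Level} (R : CommutativeRing c ℓ) where
  open CommutativeRing R
  natMul : ℕ → Carrier
  natMul zero      = 0#
  natMul (ℕ.suc n) = 1# + natMul n

record CDVF (c ℓ : Level) : Set (Level.suc (c ⊔ ℓ)) where
  field
    R : CommutativeRing c ℓ
  open CommutativeRing R public
  field
    1≉0      : ¬ (1# ≈ 0#)
    inverse  : ∀ x → ¬ (x ≈ 0#) → ∃ λ y → x * y ≈ 1#
    p        : ℕ
    p-prime  : Prime p
    char-p   : natMul R p ≈ 0#
    ord      : Carrier → Maybe ℤ
    ord-cong : ∀ {x y} → x ≈ y → ord x ≡ ord y
    ord-∞⇒0  : ∀ x → ord x ≡ nothing → x ≈ 0#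
    ord-0⇒∞  : ∀ x → x ≈ 0# → ord x ≡ nothing
    ord-mul  : ∀ x y → ord (x * y) ≡ ord x +∞ ord y
    ord-add  : ∀ x y n → AtLeast (ord x) n → AtLeast (ord y) n →
               AtLeast (ord (x + y)) n
    ord-surj : ∀ (n : ℤ) → ∃ λ x → ord x ≡ just n   -- normalized
    complete : ∀ (a : ℕ → Carrier) →
               (∀ (N : ℤ) → ∃ λ M → ∀ i j → M ℕ.≤ i → M ℕ.≤ j →
                  AtLeast (ord (a i - a j)) N) →
               ∃ λ L → ∀ (N : ℤ) → ∃ λ M → ∀ i → M ℕ.≤ i →
                  AtLeast (ord (a i - L)) N

module Filtrations {c ℓ : Level} (K : CDVF c ℓ) where
  open CDVF K

  Subset : Set (Level.suc (c ⊔ ℓ))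
  Subset = Carrier → Set (c ⊔ ℓ)

  fil : ℤ → Subset
  fil n a = Level.Lift (c ⊔ ℓ) (AtLeast (ord a) (ℤ.- n))

  -- fil_n W_s(K) for s ∈ {0,1}:  W_0(K) = 0, W_1(K) = K
  filW : ℕ → ℤ → Subset
  filW zero      n a = Level.Lift c (a ≈ 0#)
  filW (ℕ.suc _) n a = fil n a

  _⊕_ : Subset → Subset → Subset
  (A ⊕ B) x = ∃ λ a → ∃ λ b → A a × B b × (x ≈ a + b)

  r′ : ℕ → ℕ → ℕ
  r′ r m = ordp p m ⊓ ℕ.suc r

  s″ : ℕ → ℕ → ℕ
  s″ r m = r′ r m ∸ r

  fil′ : ℕ → ℕ → Subset
  fil′ r m = fil (ℤ.+ fl (m ∸ 1) (p ^ r)) ⊕ filW (s″ r m) (ℤ.+ fl m (p ^ r))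

  fil″ : ℕ → ℕ → Subset
  fil″ r m = fil (ℤ.+ fl (fl (m ∸ 1) p) (p ^ r)) ⊕ filW (s″ r m) (ℤ.+ fl (fl m p) (p ^ r))

  -- A subquotient A/B of K (B ⊆ A) is represented by the pair (A , B).
  -- Equality of subsets
  _≐_ : Subset → Subset → Set (c ⊔ ℓ)
  A ≐ B = ∀ x → (A x → B x) × (B x → A x)

  SubquotEq : Subset → Subset → Subset → Subset → Set (c ⊔ ℓ)
  SubquotEq A B C D = (A ≐ C) × (B ≐ D)

  SubquotZero : Subset → Subset → Set (c ⊔ ℓ)
  SubquotZero A B = ∀ x → A x → B x

  gr′≡gr : ℕ → ℕ → ℤ → Set (c ⊔ ℓ)
  gr′≡gr r m n = SubquotEq (fil′ r m) (fil′ r (m ∸ 1)) (fil n) (fil (n ℤ.- ℤ.+ 1))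

  gr′≡0 : ℕ → ℕ → Set (c ⊔ ℓ)
  gr′≡0 r m = SubquotZero (fil′ r m) (fil′ r (m ∸ 1))

  gr″≡gr : ℕ → ℕ → ℤ → Set (c ⊔ ℓ)
  gr″≡gr r m n = SubquotEq (fil″ r m) (fil″ r (m ∸ 1)) (fil n) (fil (n ℤ.- ℤ.+ 1))

  gr″≡0 : ℕ → ℕ → Set (c ⊔ ℓ)
  gr″≡0 r m = SubquotZero (fil″ r m) (fil″ r (m ∸ 1))

module Submission where

-- Both fil'^{(r)}_m and fil''^{(r)}_m are sums  fil_a K + fil_b W_s(K)  with
-- s = s'' ∈ {0,1}; since s'' = 1 exactly when p^{r+1} ∣ m, each of them is a
-- single lattice fil_ℓ K whose level ℓ is an explicit floor quotient:
--   fil''_m = fil_{[m/p^{r+1}]}                       (for every m ≥ 1),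
--   fil'_m  = fil_{[m/p^r]}      if p^{r+1} ∣ m, or more generally ord_p m ≠ r,
--   fil'_m  = fil_{[(m-1)/p^r]}  if p^{r+1} ∤ m.
-- A graded piece fil_m/fil_{m-1} is then gr_ℓ K when the level jumps by one
-- from m-1 to m, and 0 when the level stays put; whether it jumps is decided
-- by how [x/P] changes from x to x+1 (it grows iff P ∣ x+1).

open import Defs
open import Level using (Level; lift)
open import Data.Nat using (ℕ; zero; suc; _≤_; _<_; _∸_; _^_; _+_; _*_; _⊓_; z≤n; s≤s; z<s; nonTrivial⇒n>1)
open import Data.Nat.Properties
  using (+-comm; ≤-trans; ≤-<-trans; <-≤-trans; <⇒≤; ^-monoʳ-<; ≤-refl; ≤-pred; ≤-antisym; n<1+n; n≤1+n; 1+n≰n; <⇒≢; ≮⇒≥; m≤n⇒m<n∨m≡n;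
         suc-injective; m≥n⇒m⊓n≡n; m⊓n≤m; m≤n⇒m∸n≡0; m∸n≤m; +-∸-assoc; n∸n≡0)
open import Data.Nat.DivMod using (_/_; _%_; m≡m%n+[m/n]*n; m%n<n; m<n⇒m/n≡0; m*n/n≡m;
                                   +-distrib-/-∣ʳ; /-monoˡ-≤; m/n/o≡m/[n*o]; m*[n/m]≡n)
open import Data.Nat.Divisibility
  using (_∣_; _∣?_; divides; ∣-trans; n∣m*n; m∣m*n; *-monoʳ-∣; *-cancelˡ-∣; ∣⇒≤; ∣m+n∣m⇒∣n; ∣1⇒≡1; 1∣_; 0∣⇒≡0)
open import Data.Nat.Primality using (prime⇒nonTrivial)
open import Data.Integer as ℤ using (+_)
import Data.Integer.Properties as ℤP
open import Data.Maybe using (just; nothing)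
open import Data.Product using (_×_; _,_; proj₁; proj₂)
open import Data.Sum using (_⊎_; inj₁; inj₂; [_,_])
open import Data.Unit using (tt)
open import Data.Empty using (⊥-elim)
open import Function using (_∘_)
open import Relation.Nullary using (¬_; yes; no)
open import Relation.Binary.PropositionalEquality
  using (_≡_; refl; sym; trans; cong; cong₂; subst; module ≡-Reasoning)

fl-unique : ∀ {a P} q s → s < P → a ≡ s + q * P → fl a P ≡ q
fl-unique {P = suc e} q s s<P refl = begin
  (s + q * suc e) / suc e       ≡⟨ +-distrib-/-∣ʳ s (n∣m*n q) ⟩
  s / suc e + q * suc e / suc e ≡⟨ cong₂ _+_ (m<n⇒m/n≡0 s<P) (m*n/n≡m q (suc e)) ⟩
  q                             ∎
  where open ≡-Reasoning

fl-mono : ∀ P {a b} → a ≤ b → fl a P ≤ fl b P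
fl-mono zero    _   = z≤n
fl-mono (suc e) a≤b = /-monoˡ-≤ (suc e) a≤b

fl-suc-∣ : ∀ x P → P ∣ suc x → fl (suc x) P ≡ suc (fl x P)
fl-suc-∣ x zero P∣ with 0∣⇒≡0 P∣
... | ()
fl-suc-∣ x (suc e) (divides (suc q) eq) = begin
  fl (suc x) (suc e) ≡⟨ fl-unique (suc q) 0 z<s eq ⟩
  suc q              ≡⟨ cong suc (fl-unique q e (n<1+n e) (suc-injective eq)) ⟨
  suc (fl x (suc e)) ∎
  where open ≡-Reasoning

fl-suc-∤ : ∀ x P → ¬ P ∣ suc x → fl (suc x) P ≡ fl x P
fl-suc-∤ x zero    _  = refl
fl-suc-∤ x (suc e) P∤ = by-remainder (m≤n⇒m<n∨m≡n (m%n<n x (suc e)))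
  where
  s = x % suc e
  q = x / suc e
  x≡ : x ≡ s + q * suc e
  x≡ = m≡m%n+[m/n]*n x (suc e)
  -- x = s + qP with s < P; either s + 1 < P, or s + 1 = P and then P ∣ x + 1.
  by-remainder : suc s < suc e ⊎ suc s ≡ suc e → fl (suc x) (suc e) ≡ fl x (suc e)
  by-remainder (inj₁ s+1<P) = trans (fl-unique q (suc s) s+1<P (cong suc x≡)) (sym (fl-unique q s (m%n<n x (suc e)) x≡))
  by-remainder (inj₂ s+1≡P) = ⊥-elim (P∤ (divides (suc q) (trans (cong suc x≡) (cong (_+ q * suc e) s+1≡P))))

fl-fl : ∀ x a b → 1 ≤ a → 1 ≤ b → fl (fl x a) b ≡ fl x (a * b)
fl-fl x (suc a) (suc b) _ _ = m/n/o≡m/[n*o] x (suc a) (suc b)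

consecutive-∤ : ∀ {P x} → 2 ≤ P → P ∣ x → ¬ P ∣ suc x
consecutive-∤ {P} {x} 2≤P P∣x P∣x+1 =
  <⇒≢ 2≤P (sym (∣1⇒≡1 (∣m+n∣m⇒∣n (subst (P ∣_) (+-comm 1 x) P∣x+1) P∣x)))

-- Exponential growth: n < p^n for p ≥ 2 (so p^j ∣ m ≥ 1 forces j < m).
n<p^n : ∀ {p} n → 2 ≤ p → n < p ^ n
n<p^n     zero    _   = s≤s z≤n
n<p^n {p} (suc n) 2≤p = ≤-<-trans (n<p^n n 2≤p) (^-monoʳ-< p 2≤p (n<1+n n))

≤ordMin⇒∣ : ∀ {p} m k j → 1 ≤ p → j ≤ ordMin p m k → p ^ j ∣ m
≤ordMin⇒∣ m k zero _ _ = 1∣ m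
≤ordMin⇒∣ {p@(suc _)} m (suc k) (suc j) 1≤p j+1≤ord with p ∣? m
... | yes p∣m = subst (p * p ^ j ∣_) (m*[n/m]≡n p∣m)
                      (*-monoʳ-∣ p (≤ordMin⇒∣ (fl m p) k j 1≤p (≤-pred j+1≤ord)))
... | no _ with j+1≤ord
...   | ()

∣⇒≤ordMin : ∀ {p} m k j → 1 ≤ p → j ≤ k → p ^ j ∣ m → j ≤ ordMin p m k
∣⇒≤ordMin m k zero _ _ _ = z≤n
∣⇒≤ordMin {p@(suc _)} m (suc k) (suc j) 1≤p (s≤s j≤k) p^j+1∣m with p ∣? m
... | yes p∣m = s≤s (∣⇒≤ordMin (fl m p) k j 1≤p j≤k
                  (*-cancelˡ-∣ p (subst (p * p ^ j ∣_) (sym (m*[n/m]≡n p∣m)) p^j+1∣m)))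
... | no p∤m  = ⊥-elim (p∤m (∣-trans (m∣m*n (p ^ j)) p^j+1∣m))

≤ordp⇒∣ : ∀ {p m j} → 1 ≤ p → j ≤ ordp p m → p ^ j ∣ m
≤ordp⇒∣ {m = m} {j} 1≤p = ≤ordMin⇒∣ m m j 1≤p

∣⇒≤ordp : ∀ {p m j} → 2 ≤ p → 1 ≤ m → p ^ j ∣ m → j ≤ ordp p m
∣⇒≤ordp {p} {m@(suc _)} {j} 2≤p _ p^j∣m =
  ∣⇒≤ordMin m m j (≤-trans (s≤s z≤n) 2≤p) (<⇒≤ (<-≤-trans (n<p^n j 2≤p) (∣⇒≤ p^j∣m))) p^j∣m

∤⇒ordp≤ : ∀ {p m r} → 1 ≤ p → ¬ p ^ suc r ∣ m → ordp p m ≤ r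
∤⇒ordp≤ 1≤p p^r+1∤m = ≮⇒≥ (p^r+1∤m ∘ ≤ordp⇒∣ 1≤p)

ordp≡⇒∣ : ∀ {p m r} → 1 ≤ p → ordp p m ≡ r → p ^ r ∣ m
ordp≡⇒∣ 1≤p refl = ≤ordp⇒∣ 1≤p ≤-refl

ordp≡⇒∤ : ∀ {p m r} → 2 ≤ p → 1 ≤ m → ordp p m ≡ r → ¬ p ^ suc r ∣ m
ordp≡⇒∤ 2≤p 1≤m refl p^r+1∣m = 1+n≰n (∣⇒≤ordp 2≤p 1≤m p^r+1∣m)

∣∧∤⇒ordp≡ : ∀ {p m r} → 2 ≤ p → 1 ≤ m → p ^ r ∣ m → ¬ p ^ suc r ∣ m → ordp p m ≡ r
∣∧∤⇒ordp≡ 2≤p 1≤m p^r∣m p^r+1∤m =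
  ≤-antisym (∤⇒ordp≤ (≤-trans (s≤s z≤n) 2≤p) p^r+1∤m) (∣⇒≤ordp 2≤p 1≤m p^r∣m)

s″≡1 : ∀ {p m} r → 2 ≤ p → 1 ≤ m → p ^ suc r ∣ m → ordp p m ⊓ suc r ∸ r ≡ 1
s″≡1 {p} {m} r 2≤p 1≤m p^r+1∣m = begin
  ordp p m ⊓ suc r ∸ r ≡⟨ cong (_∸ r) (m≥n⇒m⊓n≡n (∣⇒≤ordp {j = suc r} 2≤p 1≤m p^r+1∣m)) ⟩
  suc r ∸ r            ≡⟨ +-∸-assoc 1 (≤-refl {r}) ⟩
  suc (r ∸ r)          ≡⟨ cong suc (n∸n≡0 r) ⟩
  1                    ∎
  where open ≡-Reasoning

s″≡0 : ∀ {p m} r → 1 ≤ p → ¬ p ^ suc r ∣ m → ordp p m ⊓ suc r ∸ r ≡ 0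
s″≡0 {p} {m} r 1≤p p^r+1∤m =
  m≤n⇒m∸n≡0 (≤-trans (m⊓n≤m (ordp p m) (suc r)) (∤⇒ordp≤ {r = r} 1≤p p^r+1∤m))

-- Throughout, K is the valued field, p its characteristic, and in hypothesis
-- names P = p^r, Q = p^{r+1}, m the index of the graded piece, x a general index.
module Levels {c ℓ : Level} (K : CDVF c ℓ) where
  open CDVF K using (_≈_; 0#; ord; ord-cong; ord-0⇒∞; ord-add; p; p-prime)
    renaming (_+_ to _⊞_; refl to ≈-refl; sym to ≈-sym; trans to ≈-trans;
              +-identityˡ to ⊞-identityˡ; +-identityʳ to ⊞-identityʳ; +-cong to ⊞-cong)
  open Filtrations K

  2≤p : 2 ≤ p
  2≤p = nonTrivial⇒n>1 p {{prime⇒nonTrivial p-prime}}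

  1≤p : 1 ≤ p
  1≤p = ≤-trans (s≤s z≤n) 2≤p

  1≤p^ : ∀ r → 1 ≤ p ^ r
  1≤p^ r = ≤-trans (s≤s z≤n) (n<p^n r 2≤p)

  2≤p^ : ∀ r → 1 ≤ r → 2 ≤ p ^ r
  2≤p^ r 1≤r = ≤-trans (s≤s 1≤r) (n<p^n r 2≤p)

  fil-resp : ∀ {n x y} → x ≈ y → fil n x → fil n y
  fil-resp {n} x≈y (lift h) = lift (subst (λ v → AtLeast v (ℤ.- n)) (ord-cong x≈y) h)

  fil-0 : ∀ n → fil n 0#
  fil-0 n = lift (subst (λ v → AtLeast v (ℤ.- n)) (sym (ord-0⇒∞ 0# ≈-refl)) tt)

  fil-add : ∀ {n x y} → fil n x → fil n y → fil n (x ⊞ y)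
  fil-add {n} {x} {y} (lift hx) (lift hy) = lift (ord-add x y (ℤ.- n) hx hy)

  fil-mono : ∀ {a b x} → a ≤ b → fil (+ a) x → fil (+ b) x
  fil-mono {x = x} a≤b (lift h) = lift (AtLeast-mono (ord x) (ℤP.neg-mono-≤ (ℤ.+≤+ a≤b)) h)
    where
    AtLeast-mono : ∀ v {i j} → j ℤ.≤ i → AtLeast v i → AtLeast v j
    AtLeast-mono nothing  _   _ = tt
    AtLeast-mono (just k) j≤i h = ℤP.≤-trans j≤i h

  fil-≡ : ∀ {i j} → i ≡ j → fil i ≐ fil j
  fil-≡ refl x = (λ h → h) , (λ h → h)

  ≐-trans : ∀ {A B C} → A ≐ B → B ≐ C → A ≐ C
  ≐-trans A≐B B≐C x = proj₁ (B≐C x) ∘ proj₁ (A≐B x) , proj₂ (A≐B x) ∘ proj₂ (B≐C x)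

  ⊕W₀ : ∀ {s a k} → s ≡ 0 → (fil a ⊕ filW s k) ≐ fil a
  ⊕W₀ refl x =
      (λ { (y , z , fil-y , lift z≈0 , x≈y+z) →
           fil-resp (≈-sym (≈-trans x≈y+z (≈-trans (⊞-cong ≈-refl z≈0) (⊞-identityʳ y)))) fil-y })
    , (λ fil-x → x , 0# , fil-x , lift ≈-refl , ≈-sym (⊞-identityʳ x))

  ⊕W₁ : ∀ {s a b} → s ≡ 1 → a ≤ b → (fil (+ a) ⊕ filW s (+ b)) ≐ fil (+ b)
  ⊕W₁ refl a≤b x =
      (λ { (y , z , fil-y , fil-z , x≈y+z) → fil-resp (≈-sym x≈y+z) (fil-add (fil-mono a≤b fil-y) fil-z) })
    , (λ fil-x → 0# , x , fil-0 _ , fil-x , ≈-sym (⊞-identityˡ x))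

  fil′-∣ : ∀ r x → 1 ≤ x → p ^ suc r ∣ x → fil′ r x ≐ fil (+ fl x (p ^ r))
  fil′-∣ r x 1≤x Q∣x = ⊕W₁ (s″≡1 r 2≤p 1≤x Q∣x) (fl-mono (p ^ r) (m∸n≤m x 1))

  fil′-∤ : ∀ r x → ¬ p ^ suc r ∣ x → fil′ r x ≐ fil (+ fl (x ∸ 1) (p ^ r))
  fil′-∤ r x Q∤x = ⊕W₀ (s″≡0 r 1≤p Q∤x)

  fil′-off-exact : ∀ r y → ¬ ordp p (suc y) ≡ r → fil′ r (suc y) ≐ fil (+ fl (suc y) (p ^ r))
  fil′-off-exact r y ord≢r with p ^ suc r ∣? suc y
  ... | yes Q∣x = fil′-∣ r (suc y) (s≤s z≤n) Q∣x
  ... | no  Q∤x = ≐-trans (fil′-∤ r (suc y) Q∤x) (fil-≡ (cong +_ (sym (fl-suc-∤ y (p ^ r) P∤x))))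
    where
    P∤x : ¬ p ^ r ∣ suc y
    P∤x P∣x = ord≢r (∣∧∤⇒ordp≡ 2≤p (s≤s z≤n) P∣x Q∤x)

  fil″-level : ∀ r y → fil″ r (suc y) ≐ fil (+ fl (suc y) (p ^ suc r))
  fil″-level r y with p ^ suc r ∣? suc y
  ... | yes Q∣x = ≐-trans (⊕W₁ (s″≡1 r 2≤p (s≤s z≤n) Q∣x) (fl-mono (p ^ r) (fl-mono p (n≤1+n y))))
                          (fil-≡ (cong +_ (fl-fl (suc y) p (p ^ r) 1≤p (1≤p^ r))))
  ... | no  Q∤x = ≐-trans (⊕W₀ (s″≡0 r 1≤p Q∤x))
                          (fil-≡ (cong +_ (trans (fl-fl y p (p ^ r) 1≤p (1≤p^ r)) (sym (fl-suc-∤ y (p ^ suc r) Q∤x)))))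

  gr-jump : ∀ {A B a b} → A ≐ fil (+ a) → B ≐ fil (+ b) → a ≡ suc b →
            SubquotEq A B (fil (+ a)) (fil (+ a ℤ.- + 1))
  gr-jump A≐ B≐ refl = A≐ , B≐

  gr-flat : ∀ {A B a b} → A ≐ fil (+ a) → B ≐ fil (+ b) → a ≡ b → SubquotZero A B
  gr-flat A≐ B≐ refl x = proj₂ (B≐ x) ∘ proj₁ (A≐ x)

  -- Part (i), for m = n + 2 and r ≥ 1 (so that p^r ≥ 2).  If Q ∣ m, the level
  -- [m/P] of fil'_m sits one above the level [(m-2)/P] of fil'_{m-1}.
  gr′-divisible : ∀ r n → 1 ≤ r → p ^ suc r ∣ suc (suc n) →
                  gr′≡gr r (suc (suc n)) (+ fl (suc (suc n)) (p ^ r))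
  gr′-divisible r n 1≤r Q∣m = gr-jump (fil′-∣ r (suc (suc n)) (s≤s z≤n) Q∣m) (fil′-∤ r (suc n) Q∤m-1) jump
    where
    P∣m : p ^ r ∣ suc (suc n)
    P∣m = ∣-trans (n∣m*n p) Q∣m
    Q∤m-1 : ¬ p ^ suc r ∣ suc n
    Q∤m-1 Q∣m-1 = consecutive-∤ (2≤p^ (suc r) (s≤s z≤n)) Q∣m-1 Q∣m
    jump : fl (suc (suc n)) (p ^ r) ≡ suc (fl n (p ^ r))
    jump = begin
      fl (suc (suc n)) (p ^ r) ≡⟨ fl-suc-∣ (suc n) (p ^ r) P∣m ⟩
      suc (fl (suc n) (p ^ r)) ≡⟨ cong suc (fl-suc-∤ n (p ^ r) (λ P∣m-1 → consecutive-∤ (2≤p^ r 1≤r) P∣m-1 P∣m)) ⟩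
      suc (fl n (p ^ r))       ∎
      where open ≡-Reasoning

  -- If ord_p(m-1) = r, then P ∣ m-1 and Q ∤ m, m-1: the levels are [(m-1)/P] = [m/P]
  -- and [(m-2)/P], again one apart.
  gr′-exact : ∀ r n → 1 ≤ r → ordp p (suc n) ≡ r →
              gr′≡gr r (suc (suc n)) (+ fl (suc (suc n)) (p ^ r))
  gr′-exact r n 1≤r ord≡r = gr-jump A≐ (fil′-∤ r (suc n) (ordp≡⇒∤ 2≤p (s≤s z≤n) ord≡r)) jump
    where
    P∣m-1 : p ^ r ∣ suc n
    P∣m-1 = ordp≡⇒∣ 1≤p ord≡r
    P∤m : ¬ p ^ r ∣ suc (suc n)
    P∤m = consecutive-∤ (2≤p^ r 1≤r) P∣m-1
    A≐ : fil′ r (suc (suc n)) ≐ fil (+ fl (suc (suc n)) (p ^ r))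
    A≐ = ≐-trans (fil′-∤ r (suc (suc n)) (P∤m ∘ ∣-trans (n∣m*n p)))
                 (fil-≡ (cong +_ (sym (fl-suc-∤ (suc n) (p ^ r) P∤m))))
    jump : fl (suc (suc n)) (p ^ r) ≡ suc (fl n (p ^ r))
    jump = trans (fl-suc-∤ (suc n) (p ^ r) P∤m) (fl-suc-∣ n (p ^ r) P∣m-1)

  -- Otherwise both fil'_m and fil'_{m-1} are fil_{[(m-1)/P]}.
  gr′-vanish : ∀ r n → ¬ p ^ suc r ∣ suc (suc n) → ¬ ordp p (suc n) ≡ r → gr′≡0 r (suc (suc n))
  gr′-vanish r n Q∤m ord≢r = gr-flat (fil′-∤ r (suc (suc n)) Q∤m) (fil′-off-exact r n ord≢r) refl

  -- Part (ii), for m = n + 2: the levels [m/Q] and [(m-1)/Q] differ by one iff Q ∣ m.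
  gr″-divisible : ∀ r n → p ^ suc r ∣ suc (suc n) →
                  gr″≡gr r (suc (suc n)) (+ fl (suc (suc n)) (p ^ suc r))
  gr″-divisible r n Q∣m = gr-jump (fil″-level r (suc n)) (fil″-level r n) (fl-suc-∣ (suc n) (p ^ suc r) Q∣m)

  gr″-vanish : ∀ r n → ¬ p ^ suc r ∣ suc (suc n) → gr″≡0 r (suc (suc n))
  gr″-vanish r n Q∤m = gr-flat (fil″-level r (suc n)) (fil″-level r n) (fl-suc-∤ (suc n) (p ^ suc r) Q∤m)

corollary1p24 : ∀ {c ℓ : Level} (K : CDVF c ℓ) (m r : ℕ) → 2 ≤ m →
    let open CDVF K using (p)
        open Filtrations K
    in
    -- (i)
    (1 ≤ r →
      ((p ^ (r + 1) ∣ m ⊎ ordp p (m ∸ 1) ≡ r) → gr′≡gr r m (+ fl m (p ^ r)))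
      × (¬ (p ^ (r + 1) ∣ m ⊎ ordp p (m ∸ 1) ≡ r) → gr′≡0 r m))
    -- (ii)
    × ((p ^ (r + 1) ∣ m → gr″≡gr r m (+ fl m (p ^ (r + 1))))
      × (¬ (p ^ (r + 1) ∣ m) → gr″≡0 r m))
corollary1p24 K (suc (suc n)) r (s≤s (s≤s z≤n)) rewrite +-comm r 1 =
    (λ 1≤r → [ gr′-divisible r n 1≤r , gr′-exact r n 1≤r ]
           , λ neither → gr′-vanish r n (neither ∘ inj₁) (neither ∘ inj₂))
  , gr″-divisible r n
  , gr″-vanish r n
  where open Levels K
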